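{- Let $I\subseteq\mathcal P(\omega)$ be an $F_\sigma$ ideal and let $Z_k\subseteq I$ ($k\in\omega$) be unbounded in $(I,\subseteq)$. Then there are finite sets $H_k\subseteq Z_k$ such that $\bigcup_k H_k$ is unbounded in $(I,\subseteq)$.
   Context: $\mathcal P(\omega)$ is identified with the Cantor space $2^\omega$, so $F_\sigma$ refers to this topology. A family $Z\subseteq I$ is bounded if there is $Y\in I$ containing every member of $Z$, and unbounded otherwise. -}

module Defs where

open import Data.Nat using (ℕ; _<_)
open import Data.Bool using (Bool; true)
open import Data.Product using (Σ; _×_; ∃)
open import Data.List using (List)
open import Data.List.Membership.Propositional using (_∈_)
open import Relation.Nullary using (¬_; Dec)
open import Relation.Binary.PropositionalEquality using (_≡_)

-- A subset of ω, i.e. a point of the Cantor space 2^ω.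
Subset : Set
Subset = ℕ → Bool

Family : Set₁
Family = Subset → Set

_⊆_ : Subset → Subset → Set
x ⊆ y = ∀ n → x n ≡ true → y n ≡ true

_∪_ : Subset → Subset → Subset
(x ∪ y) n = Data.Bool._∨_ (x n) (y n)
  where import Data.Bool

FiniteSet : Subset → Set
FiniteSet x = Σ ℕ λ N → ∀ n → x n ≡ true → n < N

record IsIdeal (I : Family) : Set where
  field
    downward : ∀ x y → y ⊆ x → I x → I y
    union    : ∀ x y → I x → I y → I (x ∪ y)
    finite   : ∀ x → FiniteSet x → I x
    proper   : ¬ I (λ _ → true)

-- x and y agree on the first n coordinates (basic clopen neighbourhoods).
Agree : ℕ → Subset → Subset → Set
Agree n x y = ∀ m → m < n → x m ≡ y m

IsClosed : Family → Set
IsClosed C = ∀ x → (∀ n → Σ Subset λ y → C y × Agree n x y) → C x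

IsFσ : Family → Set₁
IsFσ I = Σ (ℕ → Family) λ C →
  (∀ m → IsClosed (C m)) ×
  (∀ x → I x → Σ ℕ λ m → C m x) ×
  (∀ x m → C m x → I x)

Bounded : Family → Family → Set
Bounded I Z = Σ Subset λ Y → I Y × (∀ z → Z z → z ⊆ Y)

Unbounded : Family → Family → Set
Unbounded I Z = ¬ Bounded I Z

UnionOfLists : (ℕ → List Subset) → Family
UnionOfLists H x = Σ ℕ λ k → x ∈ H k

ExcludedMiddle : Set₁
ExcludedMiddle = (P : Set) → Dec P

-- A point of a closed set C ⊆ 2^ω bounding all of Z can be found as a branch
-- of a binary tree as soon as C bounds every finite part of Z (compactness of
-- 2^ω): we choose its bits one by one, keeping the invariant that every finite
-- part of Z is bounded inside C near the current prefix.  Classically, then,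
-- if C_m is one of the closed pieces of I = ⋃_m C_m, the unbounded family Z_m
-- has a finite part H_m not bounded inside C_m.  A bound Y ∈ I of ⋃_k H_k lies
-- in some C_m and bounds H_m there, a contradiction.
module Submission where

open import Defs
open import Data.Nat using (ℕ; zero; suc; _<_; _≟_)
open import Data.Nat.Properties using (<⇒≢; m<1+n⇒m<n∨m≡n; n<1+n)
open import Data.Sum using (inj₁; inj₂)
open import Data.Bool using (Bool; true; false)
open import Data.Product using (Σ; _×_; _,_; proj₁; proj₂)
open import Data.List using (List; []; _∷_; _++_)
open import Data.List.Relation.Unary.All using (All; []; _∷_)
open import Data.List.Relation.Unary.All.Properties using (++⁺)
open import Data.List.Relation.Unary.Any using (here)
open import Data.List.Membership.Propositional using (_∈_)
open import Data.List.Membership.Propositional.Properties using (∈-++⁺ˡ; ∈-++⁺ʳ)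
open import Data.Empty using (⊥-elim)
open import Relation.Nullary using (¬_; yes; no)
open import Relation.Nullary.Decidable using (decidable-stable)
open import Relation.Binary.PropositionalEquality using (_≡_; _≢_; refl; sym; trans)

Bounded-mono : ∀ {I J Z W : Family} → (∀ x → I x → J x) → (∀ z → W z → Z z) →
               Bounded I Z → Bounded J W
Bounded-mono I⊆J W⊆Z (Y , IY , bound) = Y , I⊆J Y IY , λ z Wz → bound z (W⊆Z z Wz)

_[_]≔_ : Subset → ℕ → Bool → Subset
(s [ n ]≔ b) i with i ≟ n
... | yes _ = b
... | no _ = s i

[]≔-updates : ∀ s n b → (s [ n ]≔ b) n ≡ b
[]≔-updates s n b with n ≟ n
... | yes _ = refl
... | no n≢n = ⊥-elim (n≢n refl)

[]≔-minimal : ∀ s {n} b {i} → i ≢ n → (s [ n ]≔ b) i ≡ s i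
[]≔-minimal s {n} b {i} i≢n with i ≟ n
... | yes i≡n = ⊥-elim (i≢n i≡n)
... | no _ = refl

Agree-[]≔ : ∀ {n Y s b} → Agree n Y s → Y n ≡ b → Agree (suc n) Y (s [ n ]≔ b)
Agree-[]≔ {n} {Y} {s} {b} agree Yn≡b i i<1+n with m<1+n⇒m<n∨m≡n i<1+n
... | inj₂ refl = trans Yn≡b (sym ([]≔-updates s n b))
... | inj₁ i<n = trans (agree i i<n) (sym ([]≔-minimal s b (<⇒≢ i<n)))

module _ (em : ExcludedMiddle) {C Z : Family} (closed : IsClosed C)
         (finitely-bounded : ∀ H → All Z H → Bounded C (_∈ H)) where

  Extendable : ℕ → Subset → Set
  Extendable n s = ∀ H → All Z H → Bounded (λ Y → C Y × Agree n Y s) (_∈ H)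

  -- If H has no bound near s[n]≔false and some H' none near s[n]≔true,
  -- then a bound of H ++ H' near s would have nowhere to go at bit n.
  extend : ∀ {n s} → Extendable n s → Σ Bool λ b → Extendable (suc n) (s [ n ]≔ b)
  extend {n} {s} ext with em (Extendable (suc n) (s [ n ]≔ true))
  ... | yes ext-true = true , ext-true
  ... | no ¬ext-true = false , λ H ZH →
    decidable-stable (em _) λ ¬bound-false → ¬ext-true λ H' ZH' →
      bound-either H' (ext (H ++ H') (++⁺ ZH ZH')) ¬bound-false
    where
    bound-either : ∀ {H} H' →
      Bounded (λ Y → C Y × Agree n Y s) (_∈ H ++ H') →
      ¬ Bounded (λ Y → C Y × Agree (suc n) Y (s [ n ]≔ false)) (_∈ H) →
      Bounded (λ Y → C Y × Agree (suc n) Y (s [ n ]≔ true)) (_∈ H')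
    bound-either {H} H' (Y , (CY , agree) , bound) ¬bound-false with Y n in Yn
    ... | true = Y , (CY , Agree-[]≔ agree Yn) , λ z z∈H' → bound z (∈-++⁺ʳ H z∈H')
    ... | false = ⊥-elim (¬bound-false (Y , (CY , Agree-[]≔ agree Yn) , λ z z∈H → bound z (∈-++⁺ˡ z∈H)))

  branch : (n : ℕ) → Σ Subset (Extendable n)
  branch zero = (λ _ → false) , λ H ZH →
    Bounded-mono (λ Y CY → CY , λ _ ()) (λ _ z∈H → z∈H) (finitely-bounded H ZH)
  branch (suc n) = (prefix [ n ]≔ proj₁ next) , proj₂ next
    where
    prefix : Subset
    prefix = proj₁ (branch n)
    next : Σ Bool λ b → Extendable (suc n) (prefix [ n ]≔ b)
    next = extend (proj₂ (branch n))

  limit : Subset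
  limit i = proj₁ (branch (suc i)) i

  branch-limit : ∀ {n i} → i < n → proj₁ (branch n) i ≡ limit i
  branch-limit {suc n} {i} i<1+n with m<1+n⇒m<n∨m≡n i<1+n
  ... | inj₂ refl = refl
  ... | inj₁ i<n = trans ([]≔-minimal (proj₁ (branch n)) _ (<⇒≢ i<n)) (branch-limit i<n)

  compactness : Bounded C Z
  compactness = limit , limit∈C , limit-bounds
    where
    limit∈C : C limit
    limit∈C = closed limit λ n →
      let (Y , (CY , agree) , _) = proj₂ (branch n) [] [] in
      Y , CY , λ i i<n → trans (sym (branch-limit i<n)) (sym (agree i i<n))

    limit-bounds : ∀ z → Z z → z ⊆ limit
    limit-bounds z Zz j zj =
      let (Y , (_ , agree) , bound) = proj₂ (branch (suc j)) (z ∷ []) (Zz ∷ []) in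
      trans (sym (agree j (n<1+n j))) (bound z (here refl) j zj)

unbounded-finite-part : ExcludedMiddle → ∀ {C Z} → IsClosed C → ¬ Bounded C Z →
  Σ (List Subset) λ H → All Z H × ¬ Bounded C (_∈ H)
unbounded-finite-part em closed unbounded = decidable-stable (em _) λ no-part →
  unbounded (compactness em closed λ H ZH →
    decidable-stable (em _) λ unbounded-H → no-part (H , ZH , unbounded-H))

lemma4p4 : ExcludedMiddle → (I : Family) → IsIdeal I → IsFσ I →
    (Z : ℕ → Family) → (∀ k x → Z k x → I x) → (∀ k → Unbounded I (Z k)) →
    Σ (ℕ → List Subset) λ H → (∀ k → All (Z k) (H k)) × Unbounded I (UnionOfLists H)
lemma4p4 em I _ (C , closed , I⊆⋃C , C⊆I) Z _ unbounded =
  (λ k → proj₁ (part k)) , (λ k → proj₁ (proj₂ (part k))) , unbounded-⋃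
  where
  part : ∀ k → Σ (List Subset) λ H → All (Z k) H × ¬ Bounded (C k) (_∈ H)
  part k = unbounded-finite-part em (closed k) λ bounded →
    unbounded k (Bounded-mono (λ x → C⊆I x k) (λ _ Zz → Zz) bounded)

  unbounded-⋃ : Unbounded I (UnionOfLists λ k → proj₁ (part k))
  unbounded-⋃ (Y , IY , bound) =
    let (m , CmY) = I⊆⋃C Y IY in
    proj₂ (proj₂ (part m)) (Y , CmY , λ z z∈H → bound z (m , z∈H))
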